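{- Let $k$ and $m$ be positive integers. If $k$ is odd, then $T_k(m)\equiv 0\pmod m$. If $k$ is even, then $$T_k(m)\equiv (2^{k-1}-1)\sum_{\substack{p\mid (2m+1)\\ (p-1)\mid k}}\frac{2m+1}{p}\pmod{2m+1},$$ where the sum is over primes $p$ dividing $2m+1$ with $(p-1)\mid k$.
   Context: $T_k(m):=\sum_{j=1}^{m}(2j-1)^k$. -}

module Defs where

open import Data.Nat using (ℕ; zero; suc; _+_; _*_; _∸_; _^_)
open import Data.Nat.DivMod using (_/_)
open import Data.Nat.Divisibility using (_∣_; _∣?_)
open import Data.Nat.Primality using (Prime; prime?)
open import Data.List using (List; upTo; filter; map)
open import Data.Nat.ListAction using (sum)
open import Data.Product using (_×_)
open import Relation.Nullary.Decidable using (_×-dec_)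

T : ℕ → ℕ → ℕ
T k zero    = 0
T k (suc m) = T k m + (2 * suc m ∸ 1) ^ k

-- n / p for p ≥ 1 (p = 0 never occurs below, since 0 is not prime)
quot : ℕ → ℕ → ℕ
quot n zero    = 0
quot n (suc q) = n / suc q

relevantPrimes : ℕ → ℕ → List ℕ
relevantPrimes k n =
  filter (λ p → prime? p ×-dec (p ∣? n ×-dec (p ∸ 1) ∣? k)) (upTo (suc n))

primeSum : ℕ → ℕ → ℕ
primeSum k n = sum (map (quot n) (relevantPrimes k n))

module Submission where

-- Odd k: the terms j and m + 1 - j of T k m have bases adding up to 2m, and
-- a + b ∣ aᵏ + bᵏ for odd k, so 2m ∣ 2·T k m.
-- Even k, n = 2m + 1, S k N = Σ_{j<N} jᵏ: splitting 0, …, 2m by parity gives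
-- S k n = T k m + 2ᵏ·S k (m+1), and the reflection j ↦ n - j gives
-- S k n ≡ 2·S k (m+1) (mod n); hence T k m ≡ -(2^(k-1) - 1)·S k n.  The heart of
-- the proof is the von Staudt–type congruence S k n + Σ_{p ∣ n, (p-1) ∣ k} n/p ≡ 0
-- (mod n) for odd n (Staudt-odd), by induction over the prime factors of n:
-- S k p ≡ -[(p-1) ∣ k] (mod p) by Fermat's little theorem and a power-sum
-- recurrence; a repeated odd prime p ∣ a lifts as S k (pa) ≡ p·S k a (mod pa);
-- a new prime p ∤ a is handled modulo p and modulo a separately.

open import Defs
open import Data.Nat
open import Data.Nat.Properties
open import Data.Nat.Divisibility
open import Data.Nat.DivMod
open import Data.Nat.Induction using (<-rec)
open import Data.Nat.Combinatorics using (_C_; nC1≡n; nCn≡1; k>n⇒nCk≡0; nCk+nC[k+1]≡[n+1]C[k+1])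
open import Data.Nat.Primality
  using (Prime; prime?; euclidsLemma; ¬prime[1]; prime⇒irreducible; prime⇒nonZero; productOfPrimes≥1)
open import Data.Nat.Primality.Factorisation using (factorise; module PrimeFactorisation)
open import Data.Nat.ListAction using (sum; product)
open import Data.List using ([]; _∷_; map; filter; applyUpTo)
open import Data.List.Relation.Unary.All using (All; []; _∷_)
open import Data.Nat.Tactic.RingSolver using (solve-∀)
open import Data.Product using (_×_; _,_; ∃)
open import Data.Sum using (inj₁; inj₂)
open import Data.Empty using (⊥-elim)
open import Data.Bool using (true; false; if_then_else_)
open import Relation.Nullary using (¬_; Dec; yes; no; does)
open import Relation.Nullary.Decidable using (dec-true; dec-false; _×-dec_)
open import Relation.Unary using (Pred; Decidable)
open import Level using (0ℓ)
open import Relation.Binary.Bundles using (Setoid)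
open import Relation.Binary.Structures using (IsEquivalence)
open import Relation.Binary.PropositionalEquality
  using (_≡_; _≢_; refl; sym; trans; cong; cong₂; subst; subst₂; module ≡-Reasoning)

Σ< : (ℕ → ℕ) → ℕ → ℕ
Σ< f zero    = 0
Σ< f (suc n) = Σ< f n + f n

Σ-peel : ∀ f n → Σ< f (suc n) ≡ f 0 + Σ< (λ j → f (suc j)) n
Σ-peel f zero    = +-comm 0 (f 0)
Σ-peel f (suc n) = begin
  Σ< f (suc n) + f (suc n)                  ≡⟨ cong (_+ f (suc n)) (Σ-peel f n) ⟩
  f 0 + Σ< (λ j → f (suc j)) n + f (suc n)  ≡⟨ +-assoc (f 0) _ _ ⟩
  f 0 + Σ< (λ j → f (suc j)) (suc n)        ∎
  where open ≡-Reasoning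

Σ-split : ∀ f a b → Σ< f (a + b) ≡ Σ< f a + Σ< (λ j → f (a + j)) b
Σ-split f a zero    = trans (cong (Σ< f) (+-identityʳ a)) (sym (+-identityʳ _))
Σ-split f a (suc b) = begin
  Σ< f (a + suc b)                             ≡⟨ cong (Σ< f) (+-suc a b) ⟩
  Σ< f (a + b) + f (a + b)                     ≡⟨ cong (_+ f (a + b)) (Σ-split f a b) ⟩
  Σ< f a + Σ< (λ j → f (a + j)) b + f (a + b)  ≡⟨ +-assoc (Σ< f a) _ _ ⟩
  Σ< f a + Σ< (λ j → f (a + j)) (suc b)        ∎
  where open ≡-Reasoning

Σ-const : ∀ c n → Σ< (λ _ → c) n ≡ n * c
Σ-const c zero    = refl
Σ-const c (suc n) = trans (cong (_+ c) (Σ-const c n)) (+-comm (n * c) c)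

Σ-+ : ∀ f g n → Σ< (λ j → f j + g j) n ≡ Σ< f n + Σ< g n
Σ-+ f g zero    = refl
Σ-+ f g (suc n) =
  trans (cong (_+ (f n + g n)) (Σ-+ f g n)) (+-+-comm (Σ< f n) (Σ< g n) (f n) (g n))
  where
  +-+-comm : ∀ a b c d → a + b + (c + d) ≡ a + c + (b + d)
  +-+-comm = solve-∀

Σ-* : ∀ c f n → Σ< (λ j → c * f j) n ≡ c * Σ< f n
Σ-* c f zero    = sym (*-zeroʳ c)
Σ-* c f (suc n) = trans (cong (_+ c * f n) (Σ-* c f n)) (sym (*-distribˡ-+ c (Σ< f n) (f n)))

Σ-ext : ∀ f g n → (∀ j → j < n → f j ≡ g j) → Σ< f n ≡ Σ< g n
Σ-ext f g zero    _    = refl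
Σ-ext f g (suc n) f≗g = cong₂ _+_ (Σ-ext f g n (λ j j<n → f≗g j (m<n⇒m<1+n j<n))) (f≗g n ≤-refl)

Σ-reverse : ∀ f n → Σ< f n ≡ Σ< (λ j → f (n ∸ suc j)) n
Σ-reverse f zero    = refl
Σ-reverse f (suc n) = begin
  Σ< f n + f n                          ≡⟨ +-comm (Σ< f n) (f n) ⟩
  f n + Σ< f n                          ≡⟨ cong (f n +_) (Σ-reverse f n) ⟩
  f n + Σ< (λ j → f (n ∸ suc j)) n      ≡⟨ Σ-peel (λ j → f (suc n ∸ suc j)) n ⟨
  Σ< (λ j → f (suc n ∸ suc j)) (suc n)  ∎
  where open ≡-Reasoning

Σ-swap : ∀ (f : ℕ → ℕ → ℕ) a b →
         Σ< (λ i → Σ< (λ j → f i j) b) a ≡ Σ< (λ j → Σ< (λ i → f i j) a) b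
Σ-swap f zero    b = sym (trans (Σ-const 0 b) (*-zeroʳ b))
Σ-swap f (suc a) b = begin
  Σ< (λ i → Σ< (f i) b) a + Σ< (f a) b          ≡⟨ cong (_+ Σ< (f a) b) (Σ-swap f a b) ⟩
  Σ< (λ j → Σ< (λ i → f i j) a) b + Σ< (f a) b  ≡⟨ Σ-+ (λ j → Σ< (λ i → f i j) a) (f a) b ⟨
  Σ< (λ j → Σ< (λ i → f i j) (suc a)) b         ∎
  where open ≡-Reasoning

Σ-∣ : ∀ d f n → (∀ j → j < n → d ∣ f j) → d ∣ Σ< f n
Σ-∣ d f zero    _   = d ∣0
Σ-∣ d f (suc n) d∣f = ∣m∣n⇒∣m+n (Σ-∣ d f n (λ j j<n → d∣f j (m<n⇒m<1+n j<n))) (d∣f n ≤-refl)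

Σ-vanish : ∀ f {M N} → M ≤ N → (∀ j → M ≤ j → j < N → f j ≡ 0) → Σ< f N ≡ Σ< f M
Σ-vanish f {N = zero}  z≤n  _   = refl
Σ-vanish f {M} {suc N} M≤1+N f≡0 with m≤n⇒m<n∨m≡n M≤1+N
... | inj₂ refl       = refl
... | inj₁ (s≤s M≤N) =
  trans (cong₂ _+_ (Σ-vanish f M≤N (λ j M≤j j<N → f≡0 j M≤j (m<n⇒m<1+n j<N))) (f≡0 N M≤N ≤-refl))
        (+-identityʳ (Σ< f M))

Σ-point : ∀ f g {c e} N → (∀ j → j ≢ c → f j ≡ g j) → f c ≡ g c + e → c < N →
          Σ< f N ≡ Σ< g N + e
Σ-point f g {c} {e} (suc N) f≗g fc c<1+N with m<1+n⇒m<n∨m≡n c<1+N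
... | inj₁ c<N = begin
  Σ< f N + f N        ≡⟨ cong₂ _+_ (Σ-point f g N f≗g fc c<N) (f≗g N (λ N≡c → <⇒≢ c<N (sym N≡c))) ⟩
  Σ< g N + e + g N    ≡⟨ +-assoc (Σ< g N) e (g N) ⟩
  Σ< g N + (e + g N)  ≡⟨ cong (Σ< g N +_) (+-comm e (g N)) ⟩
  Σ< g N + (g N + e)  ≡⟨ +-assoc (Σ< g N) (g N) e ⟨
  Σ< g N + g N + e    ∎
  where open ≡-Reasoning
... | inj₂ refl = begin
  Σ< f N + f N        ≡⟨ cong₂ _+_ (Σ-ext f g N (λ j j<N → f≗g j (<⇒≢ j<N))) fc ⟩
  Σ< g N + (g N + e)  ≡⟨ +-assoc (Σ< g N) (g N) e ⟨
  Σ< g N + g N + e    ∎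
  where open ≡-Reasoning

-- Congruence modulo n on ℕ, phrased without subtraction:
-- a ≋ b [ n ] means a + x * n ≡ b + y * n for some x and y.
infix 4 _≋_[_]
record _≋_[_] (a b n : ℕ) : Set where
  constructor shift
  field
    x y   : ℕ
    witness : a + x * n ≡ b + y * n

module _ {n : ℕ} where

  ≋-refl : ∀ {a} → a ≋ a [ n ]
  ≋-refl = shift 0 0 refl

  ≡⇒≋ : ∀ {a b} → a ≡ b → a ≋ b [ n ]
  ≡⇒≋ refl = ≋-refl

  ≋-sym : ∀ {a b} → a ≋ b [ n ] → b ≋ a [ n ]
  ≋-sym (shift x y e) = shift y x (sym e)

  ≋-trans : ∀ {a b c} → a ≋ b [ n ] → b ≋ c [ n ] → a ≋ c [ n ]
  ≋-trans {a} {b} {c} (shift x y ab) (shift u v bc) = shift (x + u) (v + y) (begin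
    a + (x + u) * n    ≡⟨ regroup a x u n ⟩
    a + x * n + u * n  ≡⟨ cong (_+ u * n) ab ⟩
    b + y * n + u * n  ≡⟨ swap b y u n ⟩
    b + u * n + y * n  ≡⟨ cong (_+ y * n) bc ⟩
    c + v * n + y * n  ≡⟨ regroup c v y n ⟨
    c + (v + y) * n    ∎)
    where
    open ≡-Reasoning
    regroup : ∀ a x u n → a + (x + u) * n ≡ a + x * n + u * n
    regroup = solve-∀
    swap : ∀ b y u n → b + y * n + u * n ≡ b + u * n + y * n
    swap = solve-∀

  ≋-isEquivalence : IsEquivalence (λ a b → a ≋ b [ n ])
  ≋-isEquivalence = record { refl = ≋-refl ; sym = ≋-sym ; trans = ≋-trans }

  ≋-+ : ∀ {a b c d} → a ≋ b [ n ] → c ≋ d [ n ] → a + c ≋ b + d [ n ]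
  ≋-+ {a} {b} {c} {d} (shift x y ab) (shift u v cd) = shift (x + u) (y + v) (begin
    a + c + (x + u) * n        ≡⟨ regroup a c x u n ⟩
    (a + x * n) + (c + u * n)  ≡⟨ cong₂ _+_ ab cd ⟩
    (b + y * n) + (d + v * n)  ≡⟨ regroup b d y v n ⟨
    b + d + (y + v) * n        ∎)
    where
    open ≡-Reasoning
    regroup : ∀ a c x u n → a + c + (x + u) * n ≡ (a + x * n) + (c + u * n)
    regroup = solve-∀

  ≋-* : ∀ {a b c d} → a ≋ b [ n ] → c ≋ d [ n ] → a * c ≋ b * d [ n ]
  ≋-* {a} {b} {c} {d} (shift x y ab) (shift u v cd) =
    shift (x * c + a * u + x * u * n) (y * d + b * v + y * v * n) (begin
      a * c + (x * c + a * u + x * u * n) * n  ≡⟨ expand a c x u n ⟩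
      (a + x * n) * (c + u * n)                ≡⟨ cong₂ _*_ ab cd ⟩
      (b + y * n) * (d + v * n)                ≡⟨ expand b d y v n ⟨
      b * d + (y * d + b * v + y * v * n) * n  ∎)
    where
    open ≡-Reasoning
    expand : ∀ a c x u n → a * c + (x * c + a * u + x * u * n) * n ≡ (a + x * n) * (c + u * n)
    expand = solve-∀

  ≋-^ : ∀ {a b} k → a ≋ b [ n ] → a ^ k ≋ b ^ k [ n ]
  ≋-^ zero    _   = ≋-refl
  ≋-^ (suc k) a≋b = ≋-* a≋b (≋-^ k a≋b)

  ≋-Σ : ∀ f g N → (∀ j → j < N → f j ≋ g j [ n ]) → Σ< f N ≋ Σ< g N [ n ]
  ≋-Σ f g zero    _   = ≋-refl
  ≋-Σ f g (suc N) f≋g = ≋-+ (≋-Σ f g N (λ j j<N → f≋g j (m<n⇒m<1+n j<N))) (f≋g N ≤-refl)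

  ≋-cancelˡ : ∀ {a b c} → c + a ≋ c + b [ n ] → a ≋ b [ n ]
  ≋-cancelˡ {a} {b} {c} (shift x y e) = shift x y (+-cancelˡ-≡ c _ _ (begin
    c + (a + x * n)  ≡⟨ +-assoc c a (x * n) ⟨
    c + a + x * n    ≡⟨ e ⟩
    c + b + y * n    ≡⟨ +-assoc c b (y * n) ⟩
    c + (b + y * n)  ∎))
    where open ≡-Reasoning

  ≋-cancelʳ : ∀ {a b c} → a + c ≋ b + c [ n ] → a ≋ b [ n ]
  ≋-cancelʳ {a} {b} {c} a+c≋b+c =
    ≋-cancelˡ (subst₂ (λ u v → u ≋ v [ n ]) (+-comm a c) (+-comm b c) a+c≋b+c)

  modulus≋0 : n ≋ 0 [ n ]
  modulus≋0 = shift 0 1 (trans (+-identityʳ n) (sym (+-identityʳ n)))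

  multiple≋0 : ∀ x → x * n ≋ 0 [ n ]
  multiple≋0 x = shift 0 x (+-identityʳ (x * n))

  multiple≋0ˡ : ∀ x → n * x ≋ 0 [ n ]
  multiple≋0ˡ x = ≋-trans (≡⇒≋ (*-comm n x)) (multiple≋0 x)

  ∣⇒≋0 : ∀ {a} → n ∣ a → a ≋ 0 [ n ]
  ∣⇒≋0 (divides q refl) = multiple≋0 q

  ≋0⇒∣ : ∀ {a} → a ≋ 0 [ n ] → n ∣ a
  ≋0⇒∣ {a} (shift x y e) =
    ∣m+n∣m⇒∣n (subst (n ∣_) (trans (sym e) (+-comm a (x * n))) (divides y refl)) (divides x refl)

  ≋⇒%≡ : ∀ {a b} .{{_ : NonZero n}} → a ≋ b [ n ] → a % n ≡ b % n
  ≋⇒%≡ {a} {b} (shift x y e) = begin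
    a % n            ≡⟨ [m+kn]%n≡m%n a x n ⟨
    (a + x * n) % n  ≡⟨ cong (_% n) e ⟩
    (b + y * n) % n  ≡⟨ [m+kn]%n≡m%n b y n ⟩
    b % n            ∎
    where open ≡-Reasoning

≋-weaken : ∀ {a b n d} → d ∣ n → a ≋ b [ n ] → a ≋ b [ d ]
≋-weaken {a} {b} {d = d} (divides q refl) (shift x y e) = shift (x * q) (y * q)
  (trans (cong (a +_) (*-assoc x q d)) (trans e (cong (b +_) (sym (*-assoc y q d)))))

≋-setoid : ℕ → Setoid _ _
≋-setoid n = record { isEquivalence = ≋-isEquivalence {n} }

module ≋-Reasoning (n : ℕ) where
  open import Relation.Binary.Reasoning.Setoid (≋-setoid n) public

pascal : ∀ n k → suc n C suc k ≡ n C k + n C suc k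
pascal n k = sym (nCk+nC[k+1]≡[n+1]C[k+1] n k)

absorption : ∀ n k → suc k * (suc n C suc k) ≡ suc n * (n C k)
absorption zero    zero    = refl
absorption zero    (suc k) = *-zeroʳ (2 + k)
absorption (suc n) zero    = trans (+-identityʳ _) (trans (nC1≡n (2 + n)) (sym (*-identityʳ (2 + n))))
absorption (suc n) (suc k) = begin
  (2 + k) * ((2 + n) C (2 + k))                   ≡⟨ cong ((2 + k) *_) (pascal (suc n) (suc k)) ⟩
  (2 + k) * (c₁ + c₂)                             ≡⟨ expand k c₁ c₂ ⟩
  (1 + k) * c₁ + c₁ + (2 + k) * c₂                ≡⟨ cong₂ (λ u v → u + c₁ + v) (absorption n k) (absorption n (suc k)) ⟩
  (1 + n) * (n C k) + c₁ + (1 + n) * (n C suc k)  ≡⟨ collect n (n C k) (n C suc k) c₁ ⟩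
  (1 + n) * (n C k + n C suc k) + c₁              ≡⟨ cong (λ u → (1 + n) * u + c₁) (pascal n k) ⟨
  (1 + n) * c₁ + c₁                               ≡⟨ +-comm ((1 + n) * c₁) c₁ ⟩
  (2 + n) * c₁                                    ∎
  where
  open ≡-Reasoning
  c₁ = suc n C suc k
  c₂ = suc n C suc (suc k)
  expand : ∀ k c₁ c₂ → (2 + k) * (c₁ + c₂) ≡ (1 + k) * c₁ + c₁ + (2 + k) * c₂
  expand = solve-∀
  collect : ∀ n a b c → (1 + n) * a + c + (1 + n) * b ≡ (1 + n) * (a + b) + c
  collect = solve-∀

binomial : ∀ x n → suc x ^ n ≡ Σ< (λ i → (n C i) * x ^ i) (suc n)
binomial x zero    = refl
binomial x (suc n) = sym (begin
  Σ< (λ i → (suc n C i) * x ^ i) (2 + n)               ≡⟨ Σ-peel _ (suc n) ⟩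
  1 + Σ< (λ i → (suc n C suc i) * x ^ suc i) (suc n)   ≡⟨ cong (1 +_) (Σ-ext _ _ (suc n) (λ i _ → pascal-term i)) ⟩
  1 + Σ< (λ i → x * a i + a (suc i)) (suc n)           ≡⟨ cong (1 +_) (Σ-+ (λ i → x * a i) (λ i → a (suc i)) (suc n)) ⟩
  1 + (Σ< (λ i → x * a i) (suc n) + rest)              ≡⟨ cong (λ u → 1 + (u + rest)) (Σ-* x a (suc n)) ⟩
  1 + (x * Σa + rest)                                  ≡⟨ shuffle (x * Σa) rest ⟩
  x * Σa + (1 + rest)                                  ≡⟨ cong (x * Σa +_) (Σ-peel a (suc n)) ⟨
  x * Σa + (Σa + (n C suc n) * x ^ suc n)              ≡⟨ cong (λ c → x * Σa + (Σa + c * x ^ suc n)) (k>n⇒nCk≡0 (n<1+n n)) ⟩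
  x * Σa + (Σa + 0)                                    ≡⟨ collect x Σa ⟩
  suc x * Σa                                           ≡⟨ cong (suc x *_) (binomial x n) ⟨
  suc x * suc x ^ n                                    ∎)
  where
  open ≡-Reasoning
  a : ℕ → ℕ
  a i = (n C i) * x ^ i
  Σa   = Σ< a (suc n)
  rest = Σ< (λ i → a (suc i)) (suc n)
  pascal-term : ∀ i → (suc n C suc i) * x ^ suc i ≡ x * a i + a (suc i)
  pascal-term i = trans (cong (_* x ^ suc i) (pascal n i)) (distrib (n C i) (n C suc i) x (x ^ i))
    where
    distrib : ∀ b c x y → (b + c) * (x * y) ≡ x * (b * y) + c * (x * y)
    distrib = solve-∀
  shuffle : ∀ u w → 1 + (u + w) ≡ u + (1 + w)
  shuffle = solve-∀
  collect : ∀ x s → x * s + (s + 0) ≡ suc x * s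
  collect = solve-∀

prime∣binomial : ∀ {p} i → Prime p → suc i < p → p ∣ p C suc i
prime∣binomial {suc n} i pr i<n
  with euclidsLemma (suc i) (suc n C suc i) pr (divides (n C i) (trans (absorption n i) (*-comm (suc n) _)))
... | inj₁ p∣1+i = ⊥-elim (>⇒∤ i<n p∣1+i)
... | inj₂ p∣C   = p∣C

freshman : ∀ {p} j → Prime p → suc j ^ p ≋ 1 + j ^ p [ p ]
freshman {suc n} j pr = begin
  suc j ^ suc n                                    ≡⟨ binomial j (suc n) ⟩
  Σ< (λ i → (suc n C i) * j ^ i) (2 + n)           ≡⟨ Σ-peel _ (suc n) ⟩
  1 + (Σ< middle n + (suc n C suc n) * j ^ suc n)  ≈⟨ ≋-+ (≋-refl {a = 1}) (≋-+ (∣⇒≋0 middle≡0) ≋-refl) ⟩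
  1 + (0 + (suc n C suc n) * j ^ suc n)            ≡⟨ cong (λ c → 1 + c * j ^ suc n) (nCn≡1 (suc n)) ⟩
  1 + 1 * j ^ suc n                                ≡⟨ cong (1 +_) (*-identityˡ (j ^ suc n)) ⟩
  1 + j ^ suc n                                    ∎
  where
  open ≋-Reasoning (suc n)
  middle : ℕ → ℕ
  middle i = (suc n C suc i) * j ^ suc i
  middle≡0 : suc n ∣ Σ< middle n
  middle≡0 = Σ-∣ _ middle n (λ i i<n → ∣m⇒∣m*n _ (prime∣binomial i pr (s≤s i<n)))

fermat : ∀ {p} j → Prime p → j ^ p ≋ j [ p ]
fermat {suc n} zero    pr = ≋-refl
fermat {suc n} (suc j) pr = ≋-trans (freshman j pr) (≋-+ (≋-refl {a = 1}) (fermat j pr))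

-- Cancelling a factor j with p ∤ j modulo a prime p, in the case a ≤ b:
-- writing b = a + d, the hypothesis says p ∣ j·d, hence p ∣ d.
≋-cancel-unit-≤ : ∀ {p j a b} → Prime p → ¬ (p ∣ j) → a ≤ b → j * a ≋ j * b [ p ] → b ≋ a [ p ]
≋-cancel-unit-≤ {p} {j} {a} {b} pr p∤j a≤b ja≋jb = begin
  b      ≡⟨ m+[n∸m]≡n a≤b ⟨
  a + d  ≈⟨ ≋-+ (≋-refl {a = a}) (∣⇒≋0 p∣d) ⟩
  a + 0  ≡⟨ +-identityʳ a ⟩
  a      ∎
  where
  open ≋-Reasoning p
  d = b ∸ a
  p∣jd : p ∣ j * d
  p∣jd = ≋0⇒∣ (≋-sym (≋-cancelˡ (subst₂ (λ u v → u ≋ v [ p ])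
           (sym (+-identityʳ (j * a)))
           (trans (cong (j *_) (sym (m+[n∸m]≡n a≤b))) (*-distribˡ-+ j a d)) ja≋jb)))
  p∣d : p ∣ d
  p∣d with euclidsLemma j d pr p∣jd
  ... | inj₁ p∣j = ⊥-elim (p∤j p∣j)
  ... | inj₂ p∣d = p∣d

≋-cancel-unit : ∀ {p j a b} → Prime p → ¬ (p ∣ j) → j * a ≋ j * b [ p ] → a ≋ b [ p ]
≋-cancel-unit {a = a} {b} pr p∤j ja≋jb with ≤-total a b
... | inj₁ a≤b = ≋-sym (≋-cancel-unit-≤ pr p∤j a≤b ja≋jb)
... | inj₂ b≤a = ≋-cancel-unit-≤ pr p∤j b≤a (≋-sym ja≋jb)

fermat-unit : ∀ {n} j → Prime (suc n) → ¬ (suc n ∣ j) → j ^ n ≋ 1 [ suc n ]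
fermat-unit j pr p∤j = ≋-cancel-unit pr p∤j (≋-trans (fermat j pr) (≡⇒≋ (sym (*-identityʳ j))))

exponent-reduce : ∀ {n} j r q → Prime (suc n) → ¬ (suc n ∣ j) → j ^ (r + q * n) ≋ j ^ r [ suc n ]
exponent-reduce {n} j r q pr p∤j = begin
  j ^ (r + q * n)      ≡⟨ ^-distribˡ-+-* j r (q * n) ⟩
  j ^ r * j ^ (q * n)  ≡⟨ cong (λ e → j ^ r * j ^ e) (*-comm q n) ⟩
  j ^ r * j ^ (n * q)  ≡⟨ cong (j ^ r *_) (^-*-assoc j n q) ⟨
  j ^ r * (j ^ n) ^ q  ≈⟨ ≋-* (≋-refl {a = j ^ r}) (≋-^ q (fermat-unit j pr p∤j)) ⟩
  j ^ r * 1 ^ q        ≡⟨ cong (j ^ r *_) (^-zeroˡ q) ⟩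
  j ^ r * 1            ≡⟨ *-identityʳ (j ^ r) ⟩
  j ^ r                ∎
  where open ≋-Reasoning (suc n)

S : ℕ → ℕ → ℕ
S k N = Σ< (λ j → j ^ k) N

S-from-1 : ∀ k N → S (suc k) (suc N) ≡ Σ< (λ j → suc j ^ suc k) N
S-from-1 k N = Σ-peel (λ j → j ^ suc k) N

[n+1]Cn≡n+1 : ∀ n → suc n C n ≡ suc n
[n+1]Cn≡n+1 zero    = refl
[n+1]Cn≡n+1 (suc n) = trans (pascal (suc n) n) (trans (cong₂ _+_ ([n+1]Cn≡n+1 n) (nCn≡1 (suc n))) (+-comm (suc n) 1))

-- Σ_{i ≤ k} C(k+1, i)·Sᵢ(N) = N^(k+1): sum the binomial expansions of
-- (j + 1)^(k+1) over j < N; the top terms telescope.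
power-sum-recurrence : ∀ k N → Σ< (λ i → (suc k C i) * S i N) (suc k) ≡ N ^ suc k
power-sum-recurrence k N = +-cancelʳ-≡ (S (suc k) N) _ _ (begin
  lower + S (suc k) N                                  ≡⟨ cong (lower +_) (*-identityˡ _) ⟨
  lower + 1 * S (suc k) N                              ≡⟨ cong (λ c → lower + c * S (suc k) N) (nCn≡1 (suc k)) ⟨
  Σ< (λ i → (suc k C i) * S i N) (2 + k)               ≡⟨ Σ-ext _ _ (2 + k) (λ i _ → Σ-* (suc k C i) (λ j → j ^ i) N) ⟨
  Σ< (λ i → Σ< (λ j → (suc k C i) * j ^ i) N) (2 + k)  ≡⟨ Σ-swap (λ i j → (suc k C i) * j ^ i) (2 + k) N ⟩
  Σ< (λ j → Σ< (λ i → (suc k C i) * j ^ i) (2 + k)) N  ≡⟨ Σ-ext _ _ N (λ j _ → binomial j (suc k)) ⟨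
  Σ< (λ j → suc j ^ suc k) N                           ≡⟨ S-from-1 k N ⟨
  S (suc k) N + N ^ suc k                              ≡⟨ +-comm (S (suc k) N) _ ⟩
  N ^ suc k + S (suc k) N                              ∎)
  where
  open ≡-Reasoning
  lower = Σ< (λ i → (suc k C i) * S i N) (suc k)

-- A prime p divides S k p whenever k + 1 < p: by strong induction on k, the
-- recurrence at N = p leaves p ∣ (k + 1)·S k p.
prime∣S : ∀ {p} → Prime p → ∀ k → suc k < p → p ∣ S k p
prime∣S {p} pr = <-rec (λ k → suc k < p → p ∣ S k p) step
  where
  step : ∀ k → (∀ {i} → i < k → suc i < p → p ∣ S i p) → suc k < p → p ∣ S k p
  step k p∣lower k+1<p with euclidsLemma (suc k) (S k p) pr p∣top
    where
    p∣all : p ∣ Σ< (λ i → (suc k C i) * S i p) k + (suc k C k) * S k p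
    p∣all = subst (p ∣_) (sym (power-sum-recurrence k p)) (∣m⇒∣m*n (p ^ k) ∣-refl)
    p∣rest : p ∣ Σ< (λ i → (suc k C i) * S i p) k
    p∣rest = Σ-∣ p _ k (λ i i<k → ∣n⇒∣m*n (suc k C i) (p∣lower i<k (<-trans (s≤s i<k) k+1<p)))
    p∣top : p ∣ suc k * S k p
    p∣top = subst (λ c → p ∣ c * S k p) ([n+1]Cn≡n+1 k) (∣m+n∣m⇒∣n p∣all p∣rest)
  ... | inj₁ p∣k+1 = ⊥-elim (>⇒∤ k+1<p p∣k+1)
  ... | inj₂ p∣S   = p∣S

-- Modulo the prime p = n + 1 the power sum S k p, k ≥ 1, only depends on k
-- modulo n, as every summand jᵏ with 0 < j < p does (Fermat).
power-sum-reduce : ∀ {n k} .{{_ : NonZero n}} → Prime (suc n) → 1 ≤ k →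
                   S k (suc n) ≋ Σ< (λ j → suc j ^ (k % n)) n [ suc n ]
power-sum-reduce {n} {suc k′} pr _ = begin
  S k (suc n)             ≡⟨ S-from-1 k′ n ⟩
  Σ< (λ j → suc j ^ k) n  ≡⟨ Σ-ext _ _ n (λ j _ → cong (suc j ^_) (m≡m%n+[m/n]*n k n)) ⟩
  Σ< (λ j → suc j ^ (k % n + (k / n) * n)) n
                                    ≈⟨ ≋-Σ _ _ n (λ j j<n → exponent-reduce (suc j) (k % n) (k / n) pr (>⇒∤ (s≤s j<n))) ⟩
  Σ< (λ j → suc j ^ (k % n)) n      ∎
  where
  open ≋-Reasoning (suc n)
  k = suc k′

power-sum-div : ∀ {n k} .{{_ : NonZero n}} → Prime (suc n) → 1 ≤ k → n ∣ k → suc n ∣ S k (suc n) + 1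
power-sum-div {n} {k} pr 1≤k n∣k = ≋0⇒∣ (begin
  S k (suc n) + 1                   ≈⟨ ≋-+ (power-sum-reduce pr 1≤k) (≋-refl {a = 1}) ⟩
  Σ< (λ j → suc j ^ (k % n)) n + 1  ≡⟨ cong (λ e → Σ< (λ j → suc j ^ e) n + 1) (n∣m⇒m%n≡0 k n n∣k) ⟩
  Σ< (λ _ → 1) n + 1                ≡⟨ cong (_+ 1) (trans (Σ-const 1 n) (*-identityʳ n)) ⟩
  n + 1                             ≡⟨ +-comm n 1 ⟩
  suc n                             ≈⟨ modulus≋0 ⟩
  0                                 ∎)
  where open ≋-Reasoning (suc n)

-- If (p - 1) ∤ k then k ≡ r (mod p - 1) with 0 < r < p - 1, and S k p ≡ S r p ≡ 0.
power-sum-ndiv : ∀ {n k} .{{_ : NonZero n}} → Prime (suc n) → 1 ≤ k → ¬ (n ∣ k) → suc n ∣ S k (suc n)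
power-sum-ndiv {n} {k} pr 1≤k n∤k with k % n in k%n≡r | m%n<n k n
... | zero  | _   = ⊥-elim (n∤k (m%n≡0⇒n∣m k n k%n≡r))
... | suc r | r<n = ≋0⇒∣ (begin
  S k (suc n)                   ≈⟨ power-sum-reduce pr 1≤k ⟩
  Σ< (λ j → suc j ^ (k % n)) n  ≡⟨ cong (λ e → Σ< (λ j → suc j ^ e) n) k%n≡r ⟩
  Σ< (λ j → suc j ^ suc r) n    ≡⟨ S-from-1 r n ⟨
  S (suc r) (suc n)             ≈⟨ ∣⇒≋0 (prime∣S pr (suc r) (s≤s r<n)) ⟩
  0                             ∎)
  where open ≋-Reasoning (suc n)

[_∣_] : ℕ → ℕ → ℕ
[ d ∣ k ] = if does (d ∣? k) then 1 else 0

[∣]-yes : ∀ {d k} → d ∣ k → [ d ∣ k ] ≡ 1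
[∣]-yes {d} {k} d∣k = cong (λ b → if b then 1 else 0) (dec-true (d ∣? k) d∣k)

[∣]-no : ∀ {d k} → ¬ (d ∣ k) → [ d ∣ k ] ≡ 0
[∣]-no {d} {k} d∤k = cong (λ b → if b then 1 else 0) (dec-false (d ∣? k) d∤k)

prime-power-sum : ∀ {p k} → Prime p → 1 ≤ k → p ∣ S k p + [ p ∸ 1 ∣ k ]
prime-power-sum {suc zero}    pr _ = ⊥-elim (¬prime[1] pr)
prime-power-sum {suc (suc n)} {k} pr 1≤k with suc n ∣? k
... | yes n∣k = subst (λ e → suc (suc n) ∣ S k (suc (suc n)) + e) (sym ([∣]-yes n∣k)) (power-sum-div pr 1≤k n∣k)
... | no  n∤k = subst (λ e → suc (suc n) ∣ S k (suc (suc n)) + e) (sym ([∣]-no n∤k))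
                  (subst (suc (suc n) ∣_) (sym (+-identityʳ _)) (power-sum-ndiv pr 1≤k n∤k))

Σ-blocks : ∀ f a b → Σ< f (b * a) ≡ Σ< (λ q → Σ< (λ r → f (q * a + r)) a) b
Σ-blocks f a zero    = refl
Σ-blocks f a (suc b) = begin
  Σ< f (a + b * a)                               ≡⟨ cong (Σ< f) (+-comm a (b * a)) ⟩
  Σ< f (b * a + a)                               ≡⟨ Σ-split f (b * a) a ⟩
  Σ< f (b * a) + Σ< (λ r → f (b * a + r)) a      ≡⟨ cong (_+ Σ< (λ r → f (b * a + r)) a) (Σ-blocks f a b) ⟩
  Σ< (λ q → Σ< (λ r → f (q * a + r)) a) (suc b)  ∎
  where open ≡-Reasoning

S-periodic : ∀ k a b → S k (b * a) ≋ b * S k a [ a ]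
S-periodic k a b = begin
  S k (b * a)                                ≡⟨ Σ-blocks (λ j → j ^ k) a b ⟩
  Σ< (λ q → Σ< (λ r → (q * a + r) ^ k) a) b  ≈⟨ ≋-Σ _ _ b (λ q _ → ≋-Σ _ _ a (λ r _ → ≋-^ k (block-shift q r))) ⟩
  Σ< (λ _ → S k a) b                         ≡⟨ Σ-const (S k a) b ⟩
  b * S k a                                  ∎
  where
  open ≋-Reasoning a
  block-shift : ∀ q r → q * a + r ≋ r [ a ]
  block-shift q r = shift 0 q (trans (+-identityʳ _) (+-comm (q * a) r))

linearize : ∀ x c k → (x + c) ^ suc k ≋ x ^ suc k + suc k * c * x ^ k [ c * c ]
linearize x c zero    = ≡⇒≋ (solve x c)
  where
  solve : ∀ x c → (x + c) * 1 ≡ x * 1 + 1 * c * 1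
  solve = solve-∀
linearize x c (suc k) = begin
  (x + c) * (x + c) ^ suc k                                              ≈⟨ ≋-* (≋-refl {a = x + c}) (linearize x c k) ⟩
  (x + c) * (x ^ suc k + suc k * c * x ^ k)                              ≡⟨ expand x c k (x ^ k) ⟩
  x ^ suc (suc k) + (2 + k) * c * x ^ suc k + (suc k * x ^ k) * (c * c)  ≈⟨ ≋-+ ≋-refl (multiple≋0 (suc k * x ^ k)) ⟩
  x ^ suc (suc k) + (2 + k) * c * x ^ suc k + 0                          ≡⟨ +-identityʳ _ ⟩
  x ^ suc (suc k) + (2 + k) * c * x ^ suc k                              ∎
  where
  open ≋-Reasoning (c * c)
  expand : ∀ x c k P → (x + c) * (x * P + (1 + k) * c * P)
                       ≡ x * (x * P) + (2 + k) * c * (x * P) + ((1 + k) * P) * (c * c)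
  expand = solve-∀

gauss-odd : ∀ t → Σ< (λ q → q) (suc (t + t)) ≡ t * suc (t + t)
gauss-odd zero    = refl
gauss-odd (suc t) = begin
  Σ< (λ q → q) (suc (suc (t + suc t)))                          ≡⟨ cong (λ n → Σ< (λ q → q) (suc (suc n))) (+-suc t t) ⟩
  Σ< (λ q → q) (suc (t + t)) + suc (t + t) + suc (suc (t + t))  ≡⟨ cong (λ s → s + suc (t + t) + suc (suc (t + t))) (gauss-odd t) ⟩
  t * suc (t + t) + suc (t + t) + suc (suc (t + t))             ≡⟨ collect t ⟩
  suc t * suc (suc (suc (t + t)))                               ≡⟨ cong (λ n → suc t * suc (suc n)) (+-suc t t) ⟨
  suc t * suc (suc (t + suc t))                                 ∎
  where
  open ≡-Reasoning
  collect : ∀ t → t * suc (t + t) + suc (t + t) + suc (suc (t + t)) ≡ suc t * suc (suc (suc (t + t)))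
  collect = solve-∀

-- For odd p = 2t + 1, the sum Σ_{q < p} c·(q·a) = c·t·(p·a) vanishes modulo p·a.
odd-multiples≋0 : ∀ c a t p → p ≡ suc (t + t) → Σ< (λ q → c * (q * a)) p ≋ 0 [ p * a ]
odd-multiples≋0 c a t p p≡2t+1 = ≋-trans (≡⇒≋ sum≡) (multiple≋0 (c * t))
  where
  open ≡-Reasoning
  sum≡ : Σ< (λ q → c * (q * a)) p ≡ c * t * (p * a)
  sum≡ = begin
    Σ< (λ q → c * (q * a)) p              ≡⟨ Σ-ext _ _ p (λ q _ → regroup c q a) ⟩
    Σ< (λ q → (c * a) * q) p              ≡⟨ Σ-* (c * a) (λ q → q) p ⟩
    (c * a) * Σ< (λ q → q) p              ≡⟨ cong (λ n → (c * a) * Σ< (λ q → q) n) p≡2t+1 ⟩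
    (c * a) * Σ< (λ q → q) (suc (t + t))  ≡⟨ cong ((c * a) *_) (gauss-odd t) ⟩
    (c * a) * (t * suc (t + t))           ≡⟨ cong (λ n → (c * a) * (t * n)) p≡2t+1 ⟨
    (c * a) * (t * p)                     ≡⟨ rearrange c a t p ⟩
    c * t * (p * a)                       ∎
    where
    regroup : ∀ c q a → c * (q * a) ≡ (c * a) * q
    regroup = solve-∀
    rearrange : ∀ c a t p → (c * a) * (t * p) ≡ c * t * (p * a)
    rearrange = solve-∀

-- In the block q·a + [0, a) the summands are r^k + k·qa·r^(k-1) modulo (qa)²,
-- which p·a divides; the cross terms add up to k·S_{k-1}(a)·Σ_{q<p} q·a ≡ 0.
S-lift : ∀ {p a k} t → p ≡ suc (t + t) → p ∣ a → 1 ≤ k → S k (p * a) ≋ p * S k a [ p * a ]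
S-lift {p} {a} {suc k′} t p≡2t+1 p∣a _ = begin
  S k (p * a)                                    ≡⟨ Σ-blocks (λ j → j ^ k) a p ⟩
  Σ< (λ q → Σ< (λ r → (q * a + r) ^ k) a) p      ≈⟨ ≋-Σ _ _ p (λ q _ → block q) ⟩
  Σ< (λ q → S k a + c * (q * a)) p               ≡⟨ Σ-+ (λ _ → S k a) (λ q → c * (q * a)) p ⟩
  Σ< (λ _ → S k a) p + Σ< (λ q → c * (q * a)) p  ≈⟨ ≋-+ (≡⇒≋ (Σ-const (S k a) p)) (odd-multiples≋0 c a t p p≡2t+1) ⟩
  p * S k a + 0                                  ≡⟨ +-identityʳ _ ⟩
  p * S k a                                      ∎
  where
  open ≋-Reasoning (p * a)
  k = suc k′
  c = k * S k′ a
  pa∣square : ∀ q → p * a ∣ (q * a) * (q * a)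
  pa∣square q = ∣-trans (*-monoˡ-∣ a p∣a) (divides (q * q) (regroup q a))
    where
    regroup : ∀ q a → (q * a) * (q * a) ≡ (q * q) * (a * a)
    regroup = solve-∀
  term : ∀ q r → (q * a + r) ^ k ≋ r ^ k + k * (q * a) * r ^ k′ [ p * a ]
  term q r = ≋-weaken (pa∣square q)
               (subst (λ x → x ^ k ≋ r ^ k + k * (q * a) * r ^ k′ [ (q * a) * (q * a) ])
                      (+-comm r (q * a)) (linearize r (q * a) k′))
  block : ∀ q → Σ< (λ r → (q * a + r) ^ k) a ≋ S k a + c * (q * a) [ p * a ]
  block q = begin
    Σ< (λ r → (q * a + r) ^ k) a               ≈⟨ ≋-Σ _ _ a (λ r _ → term q r) ⟩
    Σ< (λ r → r ^ k + k * (q * a) * r ^ k′) a  ≡⟨ Σ-+ (λ r → r ^ k) (λ r → k * (q * a) * r ^ k′) a ⟩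
    S k a + Σ< (λ r → k * (q * a) * r ^ k′) a  ≡⟨ cong (S k a +_) (Σ-* (k * (q * a)) (λ r → r ^ k′) a) ⟩
    S k a + k * (q * a) * S k′ a               ≡⟨ cong (S k a +_) (regroup k (q * a) (S k′ a)) ⟩
    S k a + c * (q * a)                        ∎
    where
    regroup : ∀ k x w → k * x * w ≡ k * w * x
    regroup = solve-∀

Σ-filter : ∀ {P : Pred ℕ 0ℓ} (P? : Decidable P) g f N →
           sum (map g (filter P? (applyUpTo f N))) ≡ Σ< (λ q → if does (P? (f q)) then g (f q) else 0) N
Σ-filter P? g f zero    = refl
Σ-filter P? g f (suc N) = trans head+tail (sym (Σ-peel (λ q → if does (P? (f q)) then g (f q) else 0) N))
  where
  head+tail : sum (map g (filter P? (applyUpTo f (suc N))))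
              ≡ (if does (P? (f 0)) then g (f 0) else 0) + Σ< (λ q → if does (P? (f (suc q))) then g (f (suc q)) else 0) N
  head+tail with does (P? (f 0))
  ... | true  = cong (g (f 0) +_) (Σ-filter P? g (λ q → f (suc q)) N)
  ... | false = Σ-filter P? g (λ q → f (suc q)) N

Relevant : ℕ → ℕ → ℕ → Set
Relevant k n q = Prime q × q ∣ n × (q ∸ 1) ∣ k

relevant? : ∀ k n q → Dec (Relevant k n q)
relevant? k n q = prime? q ×-dec (q ∣? n ×-dec (q ∸ 1) ∣? k)

term : ℕ → ℕ → ℕ → ℕ
term k n q = if does (relevant? k n q) then quot n q else 0

term-yes : ∀ {k n q} → Relevant k n q → term k n q ≡ quot n q
term-yes {k} {n} {q} r = cong (λ b → if b then quot n q else 0) (dec-true (relevant? k n q) r)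

term-no : ∀ {k n q} → ¬ Relevant k n q → term k n q ≡ 0
term-no {k} {n} {q} ¬r = cong (λ b → if b then quot n q else 0) (dec-false (relevant? k n q) ¬r)

primeSum-Σ : ∀ k n → primeSum k n ≡ Σ< (term k n) (suc n)
primeSum-Σ k n = Σ-filter (relevant? k n) (quot n) (λ q → q) (suc n)

quot-* : ∀ m n q → q ∣ n → quot (m * n) q ≡ m * quot n q
quot-* m n zero    _   = sym (*-zeroʳ m)
quot-* m n (suc q) q∣n = *-/-assoc m q∣n

quot-cancel : ∀ p a → quot (suc p * a) (suc p) ≡ a
quot-cancel p a = trans (cong (_/ suc p) (*-comm (suc p) a)) (m*n/n≡m a (suc p))

prime∣*-other : ∀ {p q a} → Prime p → Prime q → q ≢ p → q ∣ p * a → q ∣ a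
prime∣*-other {p} {q} {a} pr qr q≢p q∣pa with euclidsLemma p a qr q∣pa
... | inj₂ q∣a = q∣a
... | inj₁ q∣p with prime⇒irreducible pr q∣p
...   | inj₁ refl = ⊥-elim (¬prime[1] qr)
...   | inj₂ q≡p  = ⊥-elim (q≢p q≡p)

term-away : ∀ {p} k a q → Prime p → q ≢ p → term k (p * a) q ≡ p * term k a q
term-away {p} k a q pr q≢p with relevant? k a q
... | yes r@(qr , q∣a , d) = begin
  term k (p * a) q  ≡⟨ term-yes (qr , ∣n⇒∣m*n p q∣a , d) ⟩
  quot (p * a) q    ≡⟨ quot-* p a q q∣a ⟩
  p * quot a q      ≡⟨ cong (p *_) (term-yes r) ⟨
  p * term k a q    ∎
  where open ≡-Reasoning
... | no ¬r = begin
  term k (p * a) q  ≡⟨ term-no (λ (qr , q∣pa , d) → ¬r (qr , prime∣*-other pr qr q≢p q∣pa , d)) ⟩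
  0                 ≡⟨ *-zeroʳ p ⟨
  p * 0             ≡⟨ cong (p *_) (term-no ¬r) ⟨
  p * term k a q    ∎
  where open ≡-Reasoning

term-at-p-∣ : ∀ {p} k a → Prime p → p ∣ a → term k (p * a) p ≡ p * term k a p
term-at-p-∣ {p} k a pr p∣a = by-cases ((p ∸ 1) ∣? k)
  where
  open ≡-Reasoning
  by-cases : Dec ((p ∸ 1) ∣ k) → term k (p * a) p ≡ p * term k a p
  by-cases (yes d) = begin
    term k (p * a) p  ≡⟨ term-yes (pr , ∣n⇒∣m*n p p∣a , d) ⟩
    quot (p * a) p    ≡⟨ quot-* p a p p∣a ⟩
    p * quot a p      ≡⟨ cong (p *_) (term-yes (pr , p∣a , d)) ⟨
    p * term k a p    ∎
  by-cases (no ¬d) = begin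
    term k (p * a) p  ≡⟨ term-no {n = p * a} {q = p} (λ (_ , _ , d) → ¬d d) ⟩
    0                 ≡⟨ *-zeroʳ p ⟨
    p * 0             ≡⟨ cong (p *_) (term-no {n = a} {q = p} (λ (_ , _ , d) → ¬d d)) ⟨
    p * term k a p    ∎

term-at-p-∤ : ∀ {p} k a → Prime p → ¬ (p ∣ a) → term k (p * a) p ≡ p * term k a p + a * [ p ∸ 1 ∣ k ]
term-at-p-∤ {p@(suc d)} k a pr p∤a = begin
  term k (p * a) p                  ≡⟨ new-term (d ∣? k) ⟩
  a * [ d ∣ k ]                     ≡⟨ cong (_+ a * [ d ∣ k ]) (*-zeroʳ p) ⟨
  p * 0 + a * [ d ∣ k ]             ≡⟨ cong (λ t → p * t + a * [ d ∣ k ]) (term-no (λ (_ , p∣a , _) → p∤a p∣a)) ⟨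
  p * term k a p + a * [ d ∣ k ]    ∎
  where
  open ≡-Reasoning
  new-term : Dec (d ∣ k) → term k (p * a) p ≡ a * [ d ∣ k ]
  new-term (yes d∣k) = begin
    term k (p * a) p  ≡⟨ term-yes (pr , ∣m⇒∣m*n a ∣-refl , d∣k) ⟩
    quot (p * a) p    ≡⟨ quot-cancel d a ⟩
    a                 ≡⟨ *-identityʳ a ⟨
    a * 1             ≡⟨ cong (a *_) ([∣]-yes d∣k) ⟨
    a * [ d ∣ k ]     ∎
  new-term (no d∤k) = begin
    term k (p * a) p  ≡⟨ term-no {n = p * a} {q = p} (λ (_ , _ , d∣k) → d∤k d∣k) ⟩
    0                 ≡⟨ *-zeroʳ a ⟨
    a * 0             ≡⟨ cong (a *_) ([∣]-no d∤k) ⟨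
    a * [ d ∣ k ]     ∎

term-beyond : ∀ k n q → 1 ≤ n → n < q → term k n q ≡ 0
term-beyond k (suc n) q _ n<q = term-no {k} {suc n} {q} (λ (_ , q∣n , _) → <⇒≱ n<q (∣⇒≤ q∣n))

primeSum-* : ∀ {p} k a e → Prime p → 1 ≤ a → term k (p * a) p ≡ p * term k a p + e →
             primeSum k (p * a) ≡ p * primeSum k a + e
primeSum-* {p} k a@(suc _) e pr _ at-p = begin
  primeSum k (p * a)                           ≡⟨ primeSum-Σ k (p * a) ⟩
  Σ< (term k (p * a)) (suc (p * a))            ≡⟨ Σ-point _ _ (suc (p * a)) (λ q q≢p → term-away k a q pr q≢p) at-p (s≤s p≤pa) ⟩
  Σ< (λ q → p * term k a q) (suc (p * a)) + e  ≡⟨ cong (_+ e) (Σ-* p (term k a) (suc (p * a))) ⟩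
  p * Σ< (term k a) (suc (p * a)) + e          ≡⟨ cong (λ s → p * s + e) (Σ-vanish (term k a) (s≤s a≤pa) beyond-a) ⟩
  p * Σ< (term k a) (suc a) + e                ≡⟨ cong (λ s → p * s + e) (primeSum-Σ k a) ⟨
  p * primeSum k a + e                         ∎
  where
  open ≡-Reasoning
  instance _ = prime⇒nonZero pr
  p≤pa : p ≤ p * a
  p≤pa = m≤m*n p a
  a≤pa : a ≤ p * a
  a≤pa = m≤n*m a p
  beyond-a : ∀ q → suc a ≤ q → q < suc (p * a) → term k a q ≡ 0
  beyond-a q a<q _ = term-beyond k a q (s≤s z≤n) a<q

Staudt : ℕ → ℕ → Set
Staudt k n = n ∣ S k n + primeSum k n

prime-*-∣ : ∀ {p a X} → Prime p → ¬ (p ∣ a) → p ∣ X → a ∣ X → p * a ∣ X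
prime-*-∣ {p} {a} pr p∤a p∣X (divides c refl) with euclidsLemma c a pr p∣X
... | inj₂ p∣a          = ⊥-elim (p∤a p∣a)
... | inj₁ (divides d refl) = divides d (*-assoc d p a)

odd-form : ∀ n → ¬ (2 ∣ n) → ∃ λ t → n ≡ suc (t + t)
odd-form zero          2∤0   = ⊥-elim (2∤0 (2 ∣0))
odd-form (suc zero)    _     = 0 , refl
odd-form (suc (suc n)) 2∤n+2 with odd-form n (λ 2∣n → 2∤n+2 (∣m∣n⇒∣m+n (∣-refl {2}) 2∣n))
... | t , refl = suc t , cong (λ m → suc (suc m)) (sym (+-suc t t))

Staudt-step-∣ : ∀ {p a} k t → Prime p → p ≡ suc (t + t) → 1 ≤ a → 1 ≤ k → p ∣ a →
                Staudt k a → Staudt k (p * a)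
Staudt-step-∣ {p} {a} k t pr p≡2t+1 1≤a 1≤k p∣a IH = ≋0⇒∣ (begin
  S k (p * a) + primeSum k (p * a)  ≡⟨ cong (S k (p * a) +_) sum≡ ⟩
  S k (p * a) + p * primeSum k a    ≈⟨ ≋-+ (S-lift t p≡2t+1 p∣a 1≤k) ≋-refl ⟩
  p * S k a + p * primeSum k a      ≡⟨ *-distribˡ-+ p (S k a) (primeSum k a) ⟨
  p * (S k a + primeSum k a)        ≈⟨ ∣⇒≋0 (*-monoʳ-∣ p IH) ⟩
  0                                 ∎)
  where
  open ≋-Reasoning (p * a)
  sum≡ : primeSum k (p * a) ≡ p * primeSum k a
  sum≡ = trans (primeSum-* k a 0 pr 1≤a (trans (term-at-p-∣ k a pr p∣a) (sym (+-identityʳ _))))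
               (+-identityʳ _)

-- The inductive step for a new prime p ∤ a: check the congruence modulo a and
-- modulo p separately; modulo p it is the congruence for S k p itself.
Staudt-step-∤ : ∀ {p a} k → Prime p → 1 ≤ a → 1 ≤ k → ¬ (p ∣ a) → Staudt k a → Staudt k (p * a)
Staudt-step-∤ {p} {a} k pr 1≤a 1≤k p∤a IH =
  subst (λ s → p * a ∣ S k (p * a) + s) (sym sum≡) (prime-*-∣ pr p∤a mod-p mod-a)
  where
  ε = [ p ∸ 1 ∣ k ]
  sum≡ : primeSum k (p * a) ≡ p * primeSum k a + a * ε
  sum≡ = primeSum-* k a (a * ε) pr 1≤a (term-at-p-∤ k a pr p∤a)
  mod-a : a ∣ S k (p * a) + (p * primeSum k a + a * ε)
  mod-a = ≋0⇒∣ (begin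
    S k (p * a) + (p * primeSum k a + a * ε)  ≈⟨ ≋-+ (S-periodic k a p) (≋-+ ≋-refl (multiple≋0ˡ ε)) ⟩
    p * S k a + (p * primeSum k a + 0)        ≡⟨ cong (p * S k a +_) (+-identityʳ _) ⟩
    p * S k a + p * primeSum k a              ≡⟨ *-distribˡ-+ p (S k a) (primeSum k a) ⟨
    p * (S k a + primeSum k a)                ≈⟨ ∣⇒≋0 (∣n⇒∣m*n p IH) ⟩
    0                                         ∎)
    where open ≋-Reasoning a
  mod-p : p ∣ S k (p * a) + (p * primeSum k a + a * ε)
  mod-p = ≋0⇒∣ (begin
    S k (p * a) + (p * primeSum k a + a * ε)  ≡⟨ cong (λ n → S k n + (p * primeSum k a + a * ε)) (*-comm p a) ⟩
    S k (a * p) + (p * primeSum k a + a * ε)  ≈⟨ ≋-+ (S-periodic k p a) (≋-+ (multiple≋0ˡ (primeSum k a)) ≋-refl) ⟩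
    a * S k p + (0 + a * ε)                   ≡⟨ *-distribˡ-+ a (S k p) ε ⟨
    a * (S k p + ε)                           ≈⟨ ∣⇒≋0 (∣n⇒∣m*n a (prime-power-sum pr 1≤k)) ⟩
    0                                         ∎)
    where open ≋-Reasoning p

Staudt-step : ∀ {p a} k → Prime p → ¬ (2 ∣ p) → 1 ≤ a → 1 ≤ k → Staudt k a → Staudt k (p * a)
Staudt-step {p} {a} k pr 2∤p 1≤a 1≤k IH with p ∣? a | odd-form p 2∤p
... | yes p∣a | t , p≡2t+1 = Staudt-step-∣ k t pr p≡2t+1 1≤a 1≤k p∣a IH
... | no  p∤a | _          = Staudt-step-∤ k pr 1≤a 1≤k p∤a IH

Staudt-product : ∀ k → 1 ≤ k → ∀ ps → All Prime ps → ¬ (2 ∣ product ps) → Staudt k (product ps)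
Staudt-product k 1≤k []       []         _     = 1∣ _
Staudt-product k 1≤k (p ∷ ps) (pr ∷ prs) 2∤∏ =
  Staudt-step k pr (λ 2∣p → 2∤∏ (∣m⇒∣m*n (product ps) 2∣p)) (productOfPrimes≥1 prs) 1≤k
    (Staudt-product k 1≤k ps prs (λ 2∣∏ → 2∤∏ (∣n⇒∣m*n p 2∣∏)))

Staudt-odd : ∀ k n → 1 ≤ k → ¬ (2 ∣ n) → Staudt k n
Staudt-odd k zero      _   2∤n = ⊥-elim (2∤n (2 ∣0))
Staudt-odd k n@(suc _) 1≤k 2∤n =
  subst (Staudt k) (sym n≡∏) (Staudt-product k 1≤k ps prs (subst (λ m → ¬ (2 ∣ m)) n≡∏ 2∤n))
  where
  open PrimeFactorisation (factorise n) renaming (factors to ps; isFactorisation to n≡∏; factorsPrime to prs)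

T-as-Σ : ∀ k m → T k m ≡ Σ< (λ j → suc (2 * j) ^ k) m
T-as-Σ k zero    = refl
T-as-Σ k (suc m) = cong₂ _+_ (T-as-Σ k m) (cong (λ u → (u ∸ 1) ^ k) (*-suc 2 m))

even-power-≋ : ∀ t a b → a ^ (2 * t) ≋ b ^ (2 * t) [ a + b ]
even-power-≋ t a b = begin
  a ^ (2 * t)  ≡⟨ ^-*-assoc a 2 t ⟨
  (a ^ 2) ^ t  ≈⟨ ≋-^ t (shift b a (squares a b)) ⟩
  (b ^ 2) ^ t  ≡⟨ ^-*-assoc b 2 t ⟩
  b ^ (2 * t)  ∎
  where
  open ≋-Reasoning (a + b)
  squares : ∀ a b → a * (a * 1) + b * (a + b) ≡ b * (b * 1) + a * (a + b)
  squares = solve-∀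

odd-power-∣ : ∀ t a b → a + b ∣ a ^ suc (2 * t) + b ^ suc (2 * t)
odd-power-∣ t a b = ≋0⇒∣ (begin
  a * a ^ (2 * t) + b * b ^ (2 * t)  ≈⟨ ≋-+ (≋-* (≋-refl {a = a}) (even-power-≋ t a b)) ≋-refl ⟩
  a * b ^ (2 * t) + b * b ^ (2 * t)  ≡⟨ *-distribʳ-+ (b ^ (2 * t)) a b ⟨
  (a + b) * b ^ (2 * t)              ≈⟨ multiple≋0ˡ (b ^ (2 * t)) ⟩
  0                                  ∎)
  where open ≋-Reasoning (a + b)

-- The odd case: pairing the terms j and m - 1 - j of T k m, whose bases add up
-- to 2m, shows 2m ∣ 2·T k m.
T-odd : ∀ k m → 1 ≤ m → k % 2 ≡ 1 → m ∣ T k m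
T-odd k m@(suc _) _ k%2≡1 = *-cancelˡ-∣ 2 (subst (2 * m ∣_) (sym twice-T) (Σ-∣ (2 * m) pair m 2m∣pair))
  where
  open ≡-Reasoning
  t = k / 2
  k≡2t+1 : k ≡ suc (2 * t)
  k≡2t+1 = trans (m≡m%n+[m/n]*n k 2) (cong₂ _+_ k%2≡1 (*-comm t 2))
  f : ℕ → ℕ
  f j = suc (2 * j) ^ k
  pair : ℕ → ℕ
  pair j = f j + f (m ∸ suc j)
  twice-T : 2 * T k m ≡ Σ< pair m
  twice-T = begin
    2 * T k m                            ≡⟨ cong (2 *_) (T-as-Σ k m) ⟩
    Σ< f m + (Σ< f m + 0)                ≡⟨ cong (Σ< f m +_) (trans (+-identityʳ _) (Σ-reverse f m)) ⟩
    Σ< f m + Σ< (λ j → f (m ∸ suc j)) m  ≡⟨ Σ-+ f (λ j → f (m ∸ suc j)) m ⟨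
    Σ< pair m                            ∎
  2m∣pair : ∀ j → j < m → 2 * m ∣ pair j
  2m∣pair j j<m = subst₂ (λ d e → d ∣ suc (2 * j) ^ e + suc (2 * (m ∸ suc j)) ^ e)
                    bases-sum (sym k≡2t+1) (odd-power-∣ t (suc (2 * j)) (suc (2 * (m ∸ suc j))))
    where
    bases-sum : suc (2 * j) + suc (2 * (m ∸ suc j)) ≡ 2 * m
    bases-sum = trans (regroup j (m ∸ suc j)) (cong (2 *_) (m+[n∸m]≡n j<m))
      where
      regroup : ∀ j d → suc (2 * j) + suc (2 * d) ≡ 2 * (suc j + d)
      regroup = solve-∀

*-^ : ∀ x y k → (x * y) ^ k ≡ x ^ k * y ^ k
*-^ x y zero    = refl
*-^ x y (suc k) = trans (cong (x * y *_) (*-^ x y k)) (regroup x y (x ^ k) (y ^ k))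
  where
  regroup : ∀ x y X Y → x * y * (X * Y) ≡ x * X * (y * Y)
  regroup = solve-∀

S-parity-split : ∀ k m → 1 ≤ k → S k (suc (2 * m)) ≡ T k m + 2 ^ k * S k (suc m)
S-parity-split (suc k′) zero    _   = sym (*-zeroʳ (2 ^ suc k′))
S-parity-split k@(suc _) (suc m) 1≤k = begin
  S k (suc (2 * suc m))                            ≡⟨ cong (λ n → S k (suc n)) (*-suc 2 m) ⟩
  S k (suc (2 * m)) + odd ^ k + suc odd ^ k        ≡⟨ cong (λ s → s + odd ^ k + suc odd ^ k) (S-parity-split k m 1≤k) ⟩
  T k m + 2 ^ k * U + odd ^ k + suc odd ^ k        ≡⟨ cong (λ n → T k m + 2 ^ k * U + odd ^ k + n ^ k) (*-suc 2 m) ⟨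
  T k m + 2 ^ k * U + odd ^ k + (2 * suc m) ^ k    ≡⟨ cong (T k m + 2 ^ k * U + odd ^ k +_) (*-^ 2 (suc m) k) ⟩
  T k m + 2 ^ k * U + odd ^ k + 2 ^ k * suc m ^ k  ≡⟨ regroup (T k m) (2 ^ k) U (odd ^ k) (suc m ^ k) ⟩
  (T k m + odd ^ k) + 2 ^ k * (U + suc m ^ k)      ≡⟨ cong (λ n → (T k m + (n ∸ 1) ^ k) + 2 ^ k * (U + suc m ^ k)) (*-suc 2 m) ⟨
  T k (suc m) + 2 ^ k * S k (suc (suc m))          ∎
  where
  open ≡-Reasoning
  odd = suc (2 * m)
  U = S k (suc m)
  regroup : ∀ t c u x y → t + c * u + x + c * y ≡ (t + x) + c * (u + y)
  regroup = solve-∀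

-- For even k, the reflection j ↦ 2m + 1 - j gives S k (2m+1) ≡ 2·S k (m+1) mod 2m + 1.
S-reflect-even : ∀ k m → 1 ≤ k → k % 2 ≡ 0 → S k (suc (2 * m)) ≋ 2 * S k (suc m) [ suc (2 * m) ]
S-reflect-even k@(suc k′) m _ k%2≡0 = begin
  S k n                                      ≡⟨ S-from-1 k′ (2 * m) ⟩
  Σ< g (2 * m)                               ≡⟨ cong (λ x → Σ< g (m + x)) (+-identityʳ m) ⟩
  Σ< g (m + m)                               ≡⟨ Σ-split g m m ⟩
  Σ< g m + Σ< (λ j → g (m + j)) m            ≡⟨ cong (Σ< g m +_) (Σ-reverse (λ j → g (m + j)) m) ⟩
  Σ< g m + Σ< (λ j → g (m + (m ∸ suc j))) m  ≈⟨ ≋-+ (≋-refl {a = Σ< g m}) (≋-Σ _ _ m reflect) ⟩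
  Σ< g m + Σ< g m                            ≡⟨ cong (Σ< g m +_) (+-identityʳ (Σ< g m)) ⟨
  2 * Σ< g m                                 ≡⟨ cong (2 *_) (S-from-1 k′ m) ⟨
  2 * S k (suc m)                            ∎
  where
  open ≋-Reasoning (suc (2 * m))
  n = suc (2 * m)
  t = k / 2
  k≡2t : k ≡ 2 * t
  k≡2t = trans (m≡m%n+[m/n]*n k 2) (cong₂ _+_ k%2≡0 (*-comm t 2))
  g : ℕ → ℕ
  g j = suc j ^ k
  reflect : ∀ j → j < m → g (m + (m ∸ suc j)) ≋ g j [ n ]
  reflect j j<m = subst₂ (λ d e → suc (m + (m ∸ suc j)) ^ e ≋ suc j ^ e [ d ])
                    bases-sum (sym k≡2t) (even-power-≋ t (suc (m + (m ∸ suc j))) (suc j))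
    where
    bases-sum : suc (m + (m ∸ suc j)) + suc j ≡ n
    bases-sum = trans (regroup m (m ∸ suc j) j)
                      (cong (λ d → suc (m + d)) (trans (m+[n∸m]≡n j<m) (sym (+-identityʳ m))))
      where
      regroup : ∀ m d j → suc (m + d) + suc j ≡ suc (m + (suc j + d))
      regroup = solve-∀

2∤2m+1 : ∀ m → ¬ (2 ∣ suc (2 * m))
2∤2m+1 m 2∣2m+1 with ∣1⇒≡1 (∣m+n∣m⇒∣n (subst (2 ∣_) (+-comm 1 (2 * m)) 2∣2m+1) (divides m (*-comm 2 m)))
... | ()

-- With n = 2m + 1, c = 2^(k-1), S = S k n and R = primeSum k n:
-- the parity split and the reflection give T + c·S ≡ S, i.e. T + (c - 1)·S ≡ 0,
-- and S + R ≡ 0 turns this into T ≡ (c - 1)·R.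
T-even : ∀ k m → 1 ≤ k → k % 2 ≡ 0 →
         T k m ≋ (2 ^ (k ∸ 1) ∸ 1) * primeSum k (suc (2 * m)) [ suc (2 * m) ]
T-even k@(suc k′) m 1≤k k%2≡0 = begin
  T k m                          ≡⟨ +-identityʳ (T k m) ⟨
  T k m + 0                      ≡⟨ cong (T k m +_) (*-zeroʳ c₁) ⟨
  T k m + c₁ * 0                 ≈⟨ ≋-+ (≋-refl {a = T k m}) (≋-* (≋-refl {a = c₁}) (≋-sym staudt)) ⟩
  T k m + c₁ * (S k n + R)       ≡⟨ regroup (T k m) c₁ (S k n) R ⟩
  (T k m + c₁ * S k n) + c₁ * R  ≈⟨ ≋-+ T+c₁S≋0 (≋-refl {a = c₁ * R}) ⟩
  c₁ * R                         ∎
  where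
  open ≋-Reasoning (suc (2 * m))
  n = suc (2 * m)
  R = primeSum k n
  c = 2 ^ k′
  c₁ = c ∸ 1
  staudt : S k n + R ≋ 0 [ n ]
  staudt = ∣⇒≋0 (Staudt-odd k n 1≤k (2∤2m+1 m))
  T+c₁S≋0 : T k m + c₁ * S k n ≋ 0 [ n ]
  T+c₁S≋0 = ≋-cancelʳ (begin
    T k m + c₁ * S k n + S k n     ≡⟨ regroup′ (T k m) c₁ (S k n) ⟩
    T k m + (c₁ + 1) * S k n       ≡⟨ cong (λ d → T k m + d * S k n) (m∸n+n≡m (m^n>0 2 k′)) ⟩
    T k m + c * S k n              ≈⟨ ≋-+ (≋-refl {a = T k m}) (≋-* (≋-refl {a = c}) (S-reflect-even k m 1≤k k%2≡0)) ⟩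
    T k m + c * (2 * S k (suc m))  ≡⟨ cong (T k m +_) (double c (S k (suc m))) ⟩
    T k m + 2 ^ k * S k (suc m)    ≡⟨ S-parity-split k m 1≤k ⟨
    S k n                          ∎)
    where
    regroup′ : ∀ t c s → t + c * s + s ≡ t + (c + 1) * s
    regroup′ = solve-∀
    double : ∀ c u → c * (2 * u) ≡ 2 * c * u
    double = solve-∀
  regroup : ∀ t c s r → t + c * (s + r) ≡ (t + c * s) + c * r
  regroup = solve-∀

lemma2 : (k m : ℕ) → 1 ≤ k → 1 ≤ m →
    (k % 2 ≡ 1 → m ∣ T k m) ×
    (k % 2 ≡ 0 → T k m % (suc (2 * m)) ≡ ((2 ^ (k ∸ 1) ∸ 1) * primeSum k (suc (2 * m))) % (suc (2 * m)))
lemma2 k m 1≤k 1≤m = T-odd k m 1≤m , λ k%2≡0 → ≋⇒%≡ (T-even k m 1≤k k%2≡0)
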